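{- For integers $n\ge 2$ and $0\le k\le n-1$, \[(n-1-k)\,n^{n-2-k}\,(n-1)^{k-1}=\sum_{j=1}^{n-k-1} n^{n-k-j-2}\,(n-1)^{k+j-2}\,(2n-k-j-1).\]
   Context: The left-hand side equals the number of uprooted spanning trees of $K_n$ with root $n-k$ (spanning trees rooted at $n-k$ in which $n-k$ exceeds all its neighbours), and the $j$-th summand counts those whose largest neighbour of the root is $n-k-j$. -}

module Defs where

open import Data.Nat as ℕ using (ℕ; zero; suc)
open import Data.Integer as ℤ using (ℤ; +_; -[1+_])
open import Data.Rational as ℚ using (ℚ; 0ℚ; 1ℚ; _/_; 1/_; ≢-nonZero)
open import Data.Rational.Properties using (_≟_)
open import Relation.Nullary using (yes; no)

⟦_⟧ : ℤ → ℚ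
⟦ z ⟧ = z / 1

_^ℕ_ : ℚ → ℕ → ℚ
p ^ℕ zero  = 1ℚ
p ^ℕ suc m = p ℚ.* (p ^ℕ m)

-- integer power in ℚ:  p ^ (+ m) = p^m,  p ^ (-(m+1)) = 1 / p^(m+1).
-- Convention: 0 to a negative power is 0 (never used in the theorem,
-- where all bases are nonzero).
_^ℤ_ : ℚ → ℤ → ℚ
p ^ℤ (+ m) = p ^ℕ m
p ^ℤ -[1+ m ] with p ^ℕ suc m ≟ 0ℚ
... | yes _ = 0ℚ
... | no q≢0 = 1/_ (p ^ℕ suc m) {{≢-nonZero q≢0}}

sumFrom : ℕ → ℕ → (ℕ → ℚ) → ℚ
sumFrom a zero    f = 0ℚ
sumFrom a (suc c) f = f a ℚ.+ sumFrom (suc a) c f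

sumRange : ℕ → ℕ → (ℕ → ℚ) → ℚ
sumRange a b f = sumFrom a (suc b ℕ.∸ a) f

{-# OPTIONS --safe #-}
-- The sum telescopes.  Put T j = (n-k-j) n^(n-k-j-1) (n-1)^(k+j-2), the closed form of the
-- tail sum from j to n-k-1.  Since (n-k-j) n - (n-k-j-1) (n-1) = 2n-k-j-1, the j-th summand
-- is T j - T (j+1); so the whole sum is T 1 - T (n-k) = T 1, which is the left-hand side.
module Submission where

open import Data.Nat as ℕ using (ℕ; zero; suc; _≤_; _∸_; s≤s)
import Data.Nat.Properties as ℕ
open import Data.Integer as ℤ using (ℤ; +_; -[1+_])
open import Data.Integer.Tactic.RingSolver using (solve-∀)
open import Data.Rational as ℚ using (ℚ; 0ℚ; 1ℚ; toℚᵘ)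
open import Data.Rational.Properties
import Data.Rational.Unnormalised as ℚᵘ
import Data.Rational.Unnormalised.Properties as ℚᵘ
open import Data.Rational.Solver using (module +-*-Solver)
open import Relation.Nullary using (yes; no)
open import Relation.Binary.PropositionalEquality
open import Defs

open +-*-Solver using (_:+_; _:-_; _:*_; _:=_) renaming (solve to ℚ-solve)

toℚᵘ-⟦⟧ : ∀ a → toℚᵘ ⟦ a ⟧ ℚᵘ.≃ ℚᵘ.mkℚᵘ a 0
toℚᵘ-⟦⟧ a = toℚᵘ-fromℚᵘ (ℚᵘ.mkℚᵘ a 0)

⟦⟧-via-ℚᵘ : ∀ {p} a → toℚᵘ p ℚᵘ.≃ ℚᵘ.mkℚᵘ a 0 → ⟦ a ⟧ ≡ p
⟦⟧-via-ℚᵘ a p≃a = toℚᵘ-injective (ℚᵘ.≃-trans (toℚᵘ-⟦⟧ a) (ℚᵘ.≃-sym p≃a))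

⟦⟧-homo-* : ∀ a b → ⟦ a ℤ.* b ⟧ ≡ ⟦ a ⟧ ℚ.* ⟦ b ⟧
⟦⟧-homo-* a b = ⟦⟧-via-ℚᵘ (a ℤ.* b) (begin
  toℚᵘ (⟦ a ⟧ ℚ.* ⟦ b ⟧)                 ≈⟨ toℚᵘ-homo-* ⟦ a ⟧ ⟦ b ⟧ ⟩
  toℚᵘ ⟦ a ⟧ ℚᵘ.* toℚᵘ ⟦ b ⟧             ≈⟨ ℚᵘ.*-cong (toℚᵘ-⟦⟧ a) (toℚᵘ-⟦⟧ b) ⟩
  ℚᵘ.mkℚᵘ a 0 ℚᵘ.* ℚᵘ.mkℚᵘ b 0           ≈⟨ ℚᵘ.*≡* refl ⟩
  ℚᵘ.mkℚᵘ (a ℤ.* b) 0                    ∎)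
  where open ℚᵘ.≃-Reasoning

⟦⟧-homo-- : ∀ a b → ⟦ a ℤ.- b ⟧ ≡ ⟦ a ⟧ ℚ.- ⟦ b ⟧
⟦⟧-homo-- a b = ⟦⟧-via-ℚᵘ (a ℤ.- b) (begin
  toℚᵘ (⟦ a ⟧ ℚ.- ⟦ b ⟧)                 ≈⟨ toℚᵘ-homo-+ ⟦ a ⟧ (ℚ.- ⟦ b ⟧) ⟩
  toℚᵘ ⟦ a ⟧ ℚᵘ.+ toℚᵘ (ℚ.- ⟦ b ⟧)       ≈⟨ ℚᵘ.+-congʳ (toℚᵘ ⟦ a ⟧) (toℚᵘ-homo‿- ⟦ b ⟧) ⟩
  toℚᵘ ⟦ a ⟧ ℚᵘ.- toℚᵘ ⟦ b ⟧             ≈⟨ ℚᵘ.+-cong (toℚᵘ-⟦⟧ a) (ℚᵘ.-‿cong (toℚᵘ-⟦⟧ b)) ⟩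
  ℚᵘ.mkℚᵘ a 0 ℚᵘ.- ℚᵘ.mkℚᵘ b 0           ≈⟨ ℚᵘ.*≡* (cross-multiplied a b) ⟩
  ℚᵘ.mkℚᵘ (a ℤ.- b) 0                    ∎)
  where
  open ℚᵘ.≃-Reasoning
  cross-multiplied : ∀ a b → (a ℤ.* + 1 ℤ.+ ℤ.- b ℤ.* + 1) ℤ.* + 1 ≡ (a ℤ.- b) ℤ.* + 1
  cross-multiplied = solve-∀

⟦+⟧-pos : ∀ n .{{_ : ℕ.NonZero n}} → ℚ.Positive ⟦ + n ⟧
⟦+⟧-pos n = normalize-pos n 1

module _ (x : ℚ) {{_ : ℚ.Positive x}} where

  ^ℕ-pos : ∀ m → ℚ.Positive (x ^ℕ m)
  ^ℕ-pos zero    = _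
  ^ℕ-pos (suc m) = pos*pos⇒pos x (x ^ℕ m) {{^ℕ-pos m}}

  ^ℤ-inverseʳ : ∀ m → x ^ℕ suc m ℚ.* x ^ℤ -[1+ m ] ≡ 1ℚ
  ^ℤ-inverseʳ m with x ^ℕ suc m ≟ 0ℚ
  ... | yes xᵐ⁺¹≡0 with () ← subst ℚ.Positive xᵐ⁺¹≡0 (^ℕ-pos (suc m))
  ... | no  xᵐ⁺¹≢0 = *-inverseʳ (x ^ℕ suc m) {{ℚ.≢-nonZero xᵐ⁺¹≢0}}

  ^ℤ-suc : ∀ z → x ^ℤ ℤ.suc z ≡ x ℚ.* x ^ℤ z
  ^ℤ-suc (+ m)            = refl
  ^ℤ-suc -[1+ zero ]      = trans (sym (^ℤ-inverseʳ 0)) (cong (ℚ._* x ^ℤ -[1+ 0 ]) (*-identityʳ x))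
  ^ℤ-suc -[1+ suc m ]     = begin
    y′                          ≡⟨ *-identityʳ y′ ⟨
    y′ ℚ.* 1ℚ                   ≡⟨ cong (y′ ℚ.*_) (^ℤ-inverseʳ (suc m)) ⟨
    y′ ℚ.* (x ℚ.* xᵐ⁺¹ ℚ.* y)   ≡⟨ ℚ-solve 4 (λ x xᵐ⁺¹ y y′ → y′ :* (x :* xᵐ⁺¹ :* y) := xᵐ⁺¹ :* y′ :* (x :* y)) refl x xᵐ⁺¹ y y′ ⟩
    xᵐ⁺¹ ℚ.* y′ ℚ.* (x ℚ.* y)   ≡⟨ cong (ℚ._* (x ℚ.* y)) (^ℤ-inverseʳ m) ⟩
    1ℚ ℚ.* (x ℚ.* y)            ≡⟨ *-identityˡ (x ℚ.* y) ⟩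
    x ℚ.* y                     ∎
    where
    open ≡-Reasoning
    xᵐ⁺¹ = x ^ℕ suc m
    y    = x ^ℤ -[1+ suc m ]
    y′   = x ^ℤ -[1+ m ]

sumFrom-telescoping : ∀ {f : ℕ → ℚ} (F : ℕ → ℚ) → (∀ j → f j ≡ F j ℚ.- F (suc j)) →
                      ∀ a c → sumFrom a c f ≡ F a ℚ.- F (c ℕ.+ a)
sumFrom-telescoping F f≡ΔF a zero    = sym (+-inverseʳ (F a))
sumFrom-telescoping {f} F f≡ΔF a (suc c) = begin
  f a ℚ.+ sumFrom (suc a) c f                              ≡⟨ cong₂ ℚ._+_ (f≡ΔF a) (sumFrom-telescoping F f≡ΔF (suc a) c) ⟩
  (F a ℚ.- F (suc a)) ℚ.+ (F (suc a) ℚ.- F (c ℕ.+ suc a))  ≡⟨ ℚ-solve 3 (λ u v w → (u :- v) :+ (v :- w) := u :- w) refl (F a) (F (suc a)) _ ⟩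
  F a ℚ.- F (c ℕ.+ suc a)                                  ≡⟨ cong (λ i → F a ℚ.- F i) (ℕ.+-suc c a) ⟩
  F a ℚ.- F (suc c ℕ.+ a)                                  ∎
  where open ≡-Reasoning

module TailSum (n k : ℕ) {{_ : ℚ.Positive ⟦ + n ⟧}} {{_ : ℚ.Positive ⟦ + n ℤ.- + 1 ⟧}} where

  N B : ℚ
  N = ⟦ + n ⟧
  B = ⟦ + n ℤ.- + 1 ⟧

  lhs : ℚ
  lhs = ⟦ + n ℤ.- + 1 ℤ.- + k ⟧ ℚ.* (N ^ℤ (+ n ℤ.- + 2 ℤ.- + k)) ℚ.* (B ^ℤ (+ k ℤ.- + 1))

  summand : ℕ → ℚ
  summand j = (N ^ℤ (+ n ℤ.- + k ℤ.- + j ℤ.- + 2)) ℚ.* (B ^ℤ (+ k ℤ.+ + j ℤ.- + 2)) ℚ.* ⟦ + 2 ℤ.* + n ℤ.- + k ℤ.- + j ℤ.- + 1 ⟧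

  tailSum : ℕ → ℚ
  tailSum j = ⟦ + n ℤ.- + k ℤ.- + j ⟧ ℚ.* (N ^ℤ (+ n ℤ.- + k ℤ.- + j ℤ.- + 1)) ℚ.* (B ^ℤ (+ k ℤ.+ + j ℤ.- + 2))

  lhs≡tailSum-1 : lhs ≡ tailSum 1
  lhs≡tailSum-1 = cong₂ ℚ._*_ (cong₂ ℚ._*_ (cong ⟦_⟧ (factor (+ n) (+ k))) (cong (N ^ℤ_) (N-exponent (+ n) (+ k))))
                              (cong (B ^ℤ_) (B-exponent (+ k)))
    where
    factor : ∀ n k → n ℤ.- + 1 ℤ.- k ≡ n ℤ.- k ℤ.- + 1
    factor = solve-∀
    N-exponent : ∀ n k → n ℤ.- + 2 ℤ.- k ≡ n ℤ.- k ℤ.- + 1 ℤ.- + 1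
    N-exponent = solve-∀
    B-exponent : ∀ k → k ℤ.- + 1 ≡ k ℤ.+ + 1 ℤ.- + 2
    B-exponent = solve-∀

  tailSum-vanishes : ∀ t → t ℕ.+ k ≡ n → tailSum t ≡ 0ℚ
  tailSum-vanishes t refl = begin
    ⟦ + (t ℕ.+ k) ℤ.- + k ℤ.- + t ⟧ ℚ.* P ℚ.* Q  ≡⟨ cong (λ d → ⟦ d ⟧ ℚ.* P ℚ.* Q) (cancel (+ t) (+ k)) ⟩
    0ℚ ℚ.* P ℚ.* Q                               ≡⟨ cong (ℚ._* Q) (*-zeroˡ P) ⟩
    0ℚ ℚ.* Q                                     ≡⟨ *-zeroˡ Q ⟩
    0ℚ                                           ∎
    where
    open ≡-Reasoning
    P = N ^ℤ (+ n ℤ.- + k ℤ.- + t ℤ.- + 1)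
    Q = B ^ℤ (+ k ℤ.+ + t ℤ.- + 2)
    cancel : ∀ t k → t ℤ.+ k ℤ.- k ℤ.- t ≡ + 0
    cancel = solve-∀

  linear-factor-split : ∀ j → ⟦ + 2 ℤ.* + n ℤ.- + k ℤ.- + j ℤ.- + 1 ⟧
                            ≡ ⟦ + n ℤ.- + k ℤ.- + j ⟧ ℚ.* N ℚ.- ⟦ + n ℤ.- + k ℤ.- + suc j ⟧ ℚ.* B
  linear-factor-split j = begin
    ⟦ + 2 ℤ.* + n ℤ.- + k ℤ.- + j ℤ.- + 1 ⟧        ≡⟨ cong ⟦_⟧ (split (+ n) (+ k) (+ j)) ⟩
    ⟦ d ℤ.* + n ℤ.- d′ ℤ.* (+ n ℤ.- + 1) ⟧          ≡⟨ ⟦⟧-homo-- (d ℤ.* + n) (d′ ℤ.* (+ n ℤ.- + 1)) ⟩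
    ⟦ d ℤ.* + n ⟧ ℚ.- ⟦ d′ ℤ.* (+ n ℤ.- + 1) ⟧      ≡⟨ cong₂ ℚ._-_ (⟦⟧-homo-* d (+ n)) (⟦⟧-homo-* d′ (+ n ℤ.- + 1)) ⟩
    ⟦ d ⟧ ℚ.* N ℚ.- ⟦ d′ ⟧ ℚ.* B                    ∎
    where
    open ≡-Reasoning
    d  = + n ℤ.- + k ℤ.- + j
    d′ = + n ℤ.- + k ℤ.- + suc j
    split : ∀ n k j → + 2 ℤ.* n ℤ.- k ℤ.- j ℤ.- + 1 ≡ (n ℤ.- k ℤ.- j) ℤ.* n ℤ.- (n ℤ.- k ℤ.- (+ 1 ℤ.+ j)) ℤ.* (n ℤ.- + 1)
    split = solve-∀

  summand≡tailSum-difference : ∀ j → summand j ≡ tailSum j ℚ.- tailSum (suc j)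
  summand≡tailSum-difference j = begin
    P ℚ.* Q ℚ.* ⟦ + 2 ℤ.* + n ℤ.- + k ℤ.- + j ℤ.- + 1 ⟧   ≡⟨ cong (P ℚ.* Q ℚ.*_) (linear-factor-split j) ⟩
    P ℚ.* Q ℚ.* (D ℚ.* N ℚ.- D′ ℚ.* B)
      ≡⟨ ℚ-solve 6 (λ P Q D D′ N B → P :* Q :* (D :* N :- D′ :* B) := D :* (N :* P) :* Q :- D′ :* P :* (B :* Q))
                   refl P Q D D′ N B ⟩
    D ℚ.* (N ℚ.* P) ℚ.* Q ℚ.- D′ ℚ.* P ℚ.* (B ℚ.* Q)      ≡⟨ cong₂ ℚ._-_ tailSum-j tailSum-suc-j ⟨
    tailSum j ℚ.- tailSum (suc j)                         ∎
    where
    open ≡-Reasoning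
    e = + n ℤ.- + k ℤ.- + j ℤ.- + 2
    f = + k ℤ.+ + j ℤ.- + 2
    P = N ^ℤ e
    Q = B ^ℤ f
    D = ⟦ + n ℤ.- + k ℤ.- + j ⟧
    D′ = ⟦ + n ℤ.- + k ℤ.- + suc j ⟧
    N-exponent : ∀ n k j → n ℤ.- k ℤ.- j ℤ.- + 1 ≡ + 1 ℤ.+ (n ℤ.- k ℤ.- j ℤ.- + 2)
    N-exponent = solve-∀
    N-exponent′ : ∀ n k j → n ℤ.- k ℤ.- (+ 1 ℤ.+ j) ℤ.- + 1 ≡ n ℤ.- k ℤ.- j ℤ.- + 2
    N-exponent′ = solve-∀
    B-exponent′ : ∀ k j → k ℤ.+ (+ 1 ℤ.+ j) ℤ.- + 2 ≡ + 1 ℤ.+ (k ℤ.+ j ℤ.- + 2)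
    B-exponent′ = solve-∀
    tailSum-j : tailSum j ≡ D ℚ.* (N ℚ.* P) ℚ.* Q
    tailSum-j = cong (λ u → D ℚ.* u ℚ.* Q) (trans (cong (N ^ℤ_) (N-exponent (+ n) (+ k) (+ j))) (^ℤ-suc N e))
    tailSum-suc-j : tailSum (suc j) ≡ D′ ℚ.* P ℚ.* (B ℚ.* Q)
    tailSum-suc-j = cong₂ (λ u v → D′ ℚ.* u ℚ.* v) (cong (N ^ℤ_) (N-exponent′ (+ n) (+ k) (+ j)))
                                                  (trans (cong (B ^ℤ_) (B-exponent′ (+ k) (+ j))) (^ℤ-suc B f))

proposition4p2 : (n k : ℕ) → 2 ≤ n → k ≤ n ∸ 1 →
    ⟦ + n ℤ.- + 1 ℤ.- + k ⟧ ℚ.* (⟦ + n ⟧ ^ℤ (+ n ℤ.- + 2 ℤ.- + k)) ℚ.* (⟦ + n ℤ.- + 1 ⟧ ^ℤ (+ k ℤ.- + 1))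
      ≡ sumRange 1 (n ∸ k ∸ 1) (λ j →
          (⟦ + n ⟧ ^ℤ (+ n ℤ.- + k ℤ.- + j ℤ.- + 2)) ℚ.* (⟦ + n ℤ.- + 1 ⟧ ^ℤ (+ k ℤ.+ + j ℤ.- + 2)) ℚ.* ⟦ + 2 ℤ.* + n ℤ.- + k ℤ.- + j ℤ.- + 1 ⟧)
proposition4p2 n@(suc (suc m)) k (s≤s (s≤s _)) k≤n-1 = begin
  lhs                                          ≡⟨ lhs≡tailSum-1 ⟩
  tailSum 1                                    ≡⟨ +-identityʳ (tailSum 1) ⟨
  tailSum 1 ℚ.- 0ℚ                             ≡⟨ cong (λ u → tailSum 1 ℚ.- u) (tailSum-vanishes (c ℕ.+ 1) c+1+k≡n) ⟨
  tailSum 1 ℚ.- tailSum (c ℕ.+ 1)              ≡⟨ sumFrom-telescoping tailSum summand≡tailSum-difference 1 c ⟨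
  sumFrom 1 c summand                          ∎
  where
  instance
    _ = ⟦+⟧-pos n
    _ = ⟦+⟧-pos (suc m)
  open TailSum n k
  open ≡-Reasoning
  c = n ∸ k ∸ 1
  c+1+k≡n : c ℕ.+ 1 ℕ.+ k ≡ n
  c+1+k≡n = trans (cong (ℕ._+ k) (ℕ.m∸n+n≡m (ℕ.m<n⇒0<n∸m (s≤s k≤n-1)))) (ℕ.m∸n+n≡m (ℕ.m≤n⇒m≤1+n k≤n-1))
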